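{- Let $c$ be a complete history, let $\mathit{Match}$ be an ordered mapping for $c$, and let $d_\bot\in\mathrm{Deq}(c)$ with $\mathit{Match}(d_\bot)=\bot$. Then $\mathrm{Bad}(c,d_\bot)\cap\mathrm{Before}(c,d_\bot)=\emptyset$ if and only if there exist subsets $D\subseteq\mathrm{Deq}(c)$ and $E\subseteq\mathrm{Enq}(c)$ such that $(D\cup E)\cap\mathrm{After}(c,d_\bot)=\emptyset$, $D\cup E$ is closed under $\prec_c$, and $\mathrm{Before}(c,d_\bot)\cap\mathrm{Enq}(c)\subseteq E\subseteq\mathit{Match}(D)$.
   Context: A queue event is a tuple $(u,m,d_{in},d_{out})$ with unique identifier $u$, $m\in\{\mathtt{enq},\mathtt{deq}\}$; enqueue events carry a value in $\mathbb{N}$, dequeue events return a value in $\mathbb{N}\cup\{\mathtt{NULL}\}$. Each event $a$ has an invocation action $\mathit{inv}(a)$ and a response action $\mathit{res}(a)$. A history is a finite sequence of such actions, each occurring at most once, in which each response occurs after its invocation; it is complete if every invoked event also has its response. For a complete history $c$: $\mathrm{Enq}(c)$, $\mathrm{Deq}(c)$ are its enqueue and dequeue events; $\mathrm{Val}(c,e)$ is the value enqueued or returned by $e$; $e\prec_c e'$ iff $\mathit{res}(e)$ occurs before $\mathit{inv}(e')$ in $c$; $\mathrm{Before}(c,e)=\{e'\mid e'\prec_c e\}$, $\mathrm{After}(c,e)=\{e'\mid e\prec_c e'\}$; a set $A$ of events is closed under $\prec_c$ if $a\in A$ and $b\prec_c a$ imply $b\in A$. A total map $\mathit{Match}:\mathrm{Deq}(c)\to\mathrm{Enq}(c)\cup\{\bot\}$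 is safe if (1) $\mathit{Match}(d)\neq\bot$ implies $\mathrm{Val}(c,d)=\mathrm{Val}(c,\mathit{Match}(d))$; (2) $\mathit{Match}(d)=\bot$ iff $\mathrm{Val}(c,d)=\mathtt{NULL}$; (3) $\mathit{Match}(d)=\mathit{Match}(d')\neq\bot$ implies $d=d'$. A safe map is ordered if (1) $d\not\prec_c\mathit{Match}(d)$ for all $d\in\mathrm{Deq}(c)$ (when $\mathit{Match}(d)\neq\bot$); (2) whenever $e\in\mathrm{Enq}(c)$, $d'\in\mathrm{Deq}(c)$ and $e\prec_c\mathit{Match}(d')$, there is $d\in\mathrm{Deq}(c)$ with $\mathit{Match}(d)=e$ and $d'\not\prec_c d$. For $\mathit{Match}$ ordered and $d_\bot$ with $\mathrm{Val}(c,d_\bot)=\mathtt{NULL}$, define $\mathrm{Bad}_0=\{e\in\mathrm{Enq}(c)\mid d_\bot\prec_c e\ \lor\ \forall d\in\mathrm{Deq}(c).\ \mathit{Match}(d)=e\Rightarrow d_\bot\prec_c d\}$, $\mathrm{Bad}_{i+1}=\{e\in\mathrm{Enq}(c)\mid\exists e_i\in\mathrm{Bad}_i.\ e_i\prec_c e\ \lor\ \exists d\in\mathrm{Deq}(c).\ \mathit{Match}(d)=e\wedge e_i\prec_c d\}$, and $\mathrm{Bad}(c,d_\bot)=\bigcup_{i\in\mathbb{N}}\mathrm{Bad}_i$. $\mathit{Match}(D)=\{\mathit{Match}(d)\mid d\in D\}$. -}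

module Defs where

open import Data.Nat using (ℕ; _<_)
open import Data.Maybe using (Maybe; just; nothing)
open import Data.Fin using (Fin; toℕ)
open import Data.List using (List; length; lookup)
open import Data.List.Membership.Propositional using (_∈_)
open import Data.List.Relation.Unary.Unique.Propositional using (Unique)
open import Data.Product using (Σ; ∃; _×_; _,_)
open import Data.Sum using (_⊎_)
open import Data.Empty using (⊥)
open import Relation.Nullary using (¬_)
open import Relation.Binary.PropositionalEquality using (_≡_)

-- Queue events (u, m, d_in, d_out)
-- enq u v    : enqueue event with identifier u carrying value v ∈ ℕ
-- deq u r    : dequeue event with identifier u returning r ∈ ℕ ∪ {NULL},
--              where NULL is represented by 'nothing'.

data Event : Set where
  enq : (u : ℕ) → (v : ℕ) → Event
  deq : (u : ℕ) → (r : Maybe ℕ) → Event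

uid : Event → ℕ
uid (enq u _) = u
uid (deq u _) = u

data IsEnq : Event → Set where
  isEnq : ∀ {u v} → IsEnq (enq u v)

data IsDeq : Event → Set where
  isDeq : ∀ {u r} → IsDeq (deq u r)

Val : Event → Maybe ℕ
Val (enq _ v) = just v
Val (deq _ r) = r

data Action : Set where
  inv : Event → Action
  res : Event → Action

History : Set
History = List Action

_∈Ev_ : Event → History → Set
e ∈Ev c = inv e ∈ c

_∈Enq_ : Event → History → Set
e ∈Enq c = e ∈Ev c × IsEnq e

_∈Deq_ : Event → History → Set
e ∈Deq c = e ∈Ev c × IsDeq e

record IsHistory (c : History) : Set where
  field
    actionsUnique : Unique c
    resAfterInv   : ∀ (e : Event) (j : Fin (length c)) → lookup c j ≡ res e →
                    Σ (Fin (length c)) λ i → toℕ i < toℕ j × lookup c i ≡ inv e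
    uidsUnique    : ∀ (e e′ : Event) → e ∈Ev c → e′ ∈Ev c → uid e ≡ uid e′ → e ≡ e′

record IsCompleteHistory (c : History) : Set where
  field
    isHistory : IsHistory c
    complete  : ∀ (e : Event) → inv e ∈ c → res e ∈ c

_≺[_]_ : Event → History → Event → Set
e ≺[ c ] e′ = Σ (Fin (length c)) λ i → Σ (Fin (length c)) λ j →
  toℕ i < toℕ j × lookup c i ≡ res e × lookup c j ≡ inv e′

-- Match maps: a total map Deq(c) → Enq(c) ∪ {⊥}, represented as a function
-- Event → Maybe Event (⊥ = nothing) whose values on Deq(c) lie in Enq(c) ∪ {⊥}.
-- Values outside Deq(c) are irrelevant.

record IsMatchMap (c : History) (Match : Event → Maybe Event) : Set where
  field
    codomain : ∀ (d e : Event) → d ∈Deq c → Match d ≡ just e → e ∈Enq c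

record IsSafe (c : History) (Match : Event → Maybe Event) : Set where
  field
    isMatchMap : IsMatchMap c Match
    safe-val   : ∀ (d e : Event) → d ∈Deq c → Match d ≡ just e → Val d ≡ Val e
    safe-null₁ : ∀ (d : Event) → d ∈Deq c → Match d ≡ nothing → Val d ≡ nothing
    safe-null₂ : ∀ (d : Event) → d ∈Deq c → Val d ≡ nothing → Match d ≡ nothing
    safe-inj   : ∀ (d d′ e : Event) → d ∈Deq c → d′ ∈Deq c →
                 Match d ≡ just e → Match d′ ≡ just e → d ≡ d′

record IsOrdered (c : History) (Match : Event → Maybe Event) : Set where
  field
    isSafe    : IsSafe c Match
    ordered₁  : ∀ (d e : Event) → d ∈Deq c → Match d ≡ just e → ¬ (d ≺[ c ] e)
    ordered₂  : ∀ (e d′ e′ : Event) → e ∈Enq c → d′ ∈Deq c → Match d′ ≡ just e′ →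
                e ≺[ c ] e′ →
                Σ Event λ d → d ∈Deq c × Match d ≡ just e × ¬ (d′ ≺[ c ] d)

BadAt : History → (Event → Maybe Event) → Event → ℕ → Event → Set
BadAt c Match d⊥ ℕ.zero e =
  e ∈Enq c ×
  (d⊥ ≺[ c ] e ⊎ (∀ (d : Event) → d ∈Deq c → Match d ≡ just e → d⊥ ≺[ c ] d))
BadAt c Match d⊥ (ℕ.suc i) e =
  e ∈Enq c ×
  (Σ Event λ eᵢ → BadAt c Match d⊥ i eᵢ ×
     (eᵢ ≺[ c ] e ⊎ (Σ Event λ d → d ∈Deq c × Match d ≡ just e × eᵢ ≺[ c ] d)))

Bad : History → (Event → Maybe Event) → Event → Event → Set
Bad c Match d⊥ e = Σ ℕ λ i → BadAt c Match d⊥ i e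

DESets : History → (Event → Maybe Event) → Event → Set₁
DESets c Match d⊥ =
  Σ (Event → Set) λ D → Σ (Event → Set) λ E →
    (∀ (x : Event) → D x → x ∈Deq c) ×
    (∀ (x : Event) → E x → x ∈Enq c) ×
    (∀ (x : Event) → D x ⊎ E x → ¬ (d⊥ ≺[ c ] x)) ×
    (∀ (a b : Event) → D a ⊎ E a → b ≺[ c ] a → D b ⊎ E b) ×
    (∀ (e : Event) → e ∈Enq c → e ≺[ c ] d⊥ → E e) ×
    (∀ (e : Event) → E e → Σ Event λ d → D d × Match d ≡ just e)

BadBeforeEmpty : History → (Event → Maybe Event) → Event → Set
BadBeforeEmpty c Match d⊥ = ∀ (e : Event) → Bad c Match d⊥ e → e ≺[ c ] d⊥ → ⊥

-- ⇐: by induction on i, no element of Bad_i lies in E; since E contains every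
-- enqueue preceding d⊥, Bad(c,d⊥) misses Before(c,d⊥).
-- ⇒: call an event tainted if it is bad, is a dequeue matched to a bad enqueue,
-- or follows d⊥ or a bad enqueue. Because ≺_c is an interval order and Match is
-- ordered, everything after a tainted event is tainted, and a tainted enqueue is
-- bad. So the untainted dequeues and enqueues form the required D and E: an
-- untainted enqueue has a matching dequeue that does not follow d⊥ (else it
-- would be in Bad_0), and that dequeue is untainted too.
module Submission where

open import Defs
open import Data.Maybe using (Maybe; just; nothing)
open import Data.Product using (_×_)
open import Relation.Binary.PropositionalEquality using (_≡_)

open import Data.Nat as ℕ using (zero; suc; _<?_)
open import Data.Nat.Properties using (<-irrefl; <-trans; <-≤-trans; ≤-trans; <⇒≤; ≮⇒≥)
open import Data.Fin as Fin using (Fin; toℕ)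
open import Data.List using (List; _∷_; lookup)
open import Data.List.Relation.Unary.All as All using ()
open import Data.List.Relation.Unary.AllPairs using (_∷_)
open import Data.List.Relation.Unary.Any using (any?)
open import Data.List.Relation.Unary.Unique.Propositional using (Unique)
open import Data.List.Membership.Propositional using (_∈_; find; lose)
open import Data.List.Membership.Propositional.Properties using (∈-lookup)
open import Data.Maybe.Properties using (just-injective) renaming (≡-dec to ≡-decMaybe)
open import Data.Product using (Σ; _,_; proj₁; proj₂)
open import Data.Sum using (_⊎_; inj₁; inj₂)
open import Data.Empty using (⊥; ⊥-elim)
open import Relation.Nullary using (¬_; yes; no)
open import Relation.Nullary.Decidable using (_×-dec_; map′)
open import Relation.Unary using (Decidable)
open import Relation.Binary.Definitions using (DecidableEquality)
open import Relation.Binary.PropositionalEquality using (refl; sym; trans; cong; subst)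

lookup-injective : ∀ {A : Set} {xs : List A} → Unique xs →
                   ∀ i j → lookup xs i ≡ lookup xs j → i ≡ j
lookup-injective (_ ∷ _) Fin.zero Fin.zero _ = refl
lookup-injective {xs = _ ∷ xs} (x∉xs ∷ _) Fin.zero (Fin.suc j) eq =
  ⊥-elim (All.lookup x∉xs (∈-lookup {xs = xs} j) eq)
lookup-injective {xs = _ ∷ xs} (x∉xs ∷ _) (Fin.suc i) Fin.zero eq =
  ⊥-elim (All.lookup x∉xs (∈-lookup {xs = xs} i) (sym eq))
lookup-injective (_ ∷ unique) (Fin.suc i) (Fin.suc j) eq =
  cong Fin.suc (lookup-injective unique i j eq)

_≟ᴱ_ : DecidableEquality Event
enq u v ≟ᴱ enq u′ v′ = map′ (λ { (refl , refl) → refl }) (λ { refl → refl , refl })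
                              ((u ℕ.≟ u′) ×-dec (v ℕ.≟ v′))
enq _ _ ≟ᴱ deq _ _   = no λ ()
deq _ _ ≟ᴱ enq _ _   = no λ ()
deq u r ≟ᴱ deq u′ r′ = map′ (λ { (refl , refl) → refl }) (λ { refl → refl , refl })
                              ((u ℕ.≟ u′) ×-dec ≡-decMaybe ℕ._≟_ r r′)

isDeq? : Decidable IsDeq
isDeq? (enq _ _) = no λ ()
isDeq? (deq _ _) = yes isDeq

IsEnq⇒¬IsDeq : ∀ {x} → IsEnq x → ¬ IsDeq x
IsEnq⇒¬IsDeq isEnq ()

OnInv : (Event → Set) → Action → Set
OnInv P (inv e) = P e
OnInv P (res _) = ⊥

search-inv : ∀ {P : Event → Set} → Decidable P → (c : History) →
             (Σ Event λ e → inv e ∈ c × P e) ⊎ (∀ e → inv e ∈ c → ¬ P e)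
search-inv {P} P? c with any? onInv? c
  where
  onInv? : Decidable (OnInv P)
  onInv? (inv e) = P? e
  onInv? (res _) = no λ ()
... | no none   = inj₂ λ e e∈c Pe → none (lose e∈c Pe)
... | yes found with find found
...   | inv e , e∈c , Pe = inj₁ (e , e∈c , Pe)

-- The 2+2-freeness that makes ≺_c an interval order; it holds for any action list.
≺-interval : ∀ {c a b x y} → a ≺[ c ] b → x ≺[ c ] y → a ≺[ c ] y ⊎ x ≺[ c ] b
≺-interval (i , j , i<j , ci , cj) (k , l , k<l , ck , cl) with toℕ i <? toℕ l
... | yes i<l = inj₁ (i , l , i<l , ci , cl)
... | no  i≮l = inj₂ (k , j , <-≤-trans k<l (≤-trans (≮⇒≥ i≮l) (<⇒≤ i<j)) , ck , cj)

module _ {c : History} (H : IsHistory c) where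
  open IsHistory H

  ≺-irrefl : ∀ {a} → ¬ (a ≺[ c ] a)
  ≺-irrefl {a} (i , j , i<j , ci , cj) with resAfterInv a i ci
  ... | k , k<i , ck =
    <-irrefl (cong toℕ (sym (lookup-injective actionsUnique j k (trans cj (sym ck)))))
             (<-trans k<i i<j)

  ≺-trans : ∀ {a b x} → a ≺[ c ] b → b ≺[ c ] x → a ≺[ c ] x
  ≺-trans a≺b b≺x with ≺-interval {c} a≺b b≺x
  ... | inj₁ a≺x = a≺x
  ... | inj₂ b≺b = ⊥-elim (≺-irrefl b≺b)

  ≺-∈Ev : ∀ {a b} → a ≺[ c ] b → a ∈Ev c
  ≺-∈Ev {a} (i , _ , _ , ci , _) with resAfterInv a i ci
  ... | k , _ , ck = subst (_∈ c) ck (∈-lookup {xs = c} k)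

BadAt-∈Enq : ∀ {c Match d⊥} i {e} → BadAt c Match d⊥ i e → e ∈Enq c
BadAt-∈Enq zero    = proj₁
BadAt-∈Enq (suc i) = proj₁

DESets⇒BadBeforeEmpty : ∀ {c Match d⊥} → IsSafe c Match →
                        DESets c Match d⊥ → BadBeforeEmpty c Match d⊥
DESets⇒BadBeforeEmpty {c} {Match} {d⊥} S
  (D , E , D⊆Deq , _ , notAfter , closed , before⊆E , E⊆MatchD) e (i , bad) e≺d⊥ =
  bad∉E i bad (before⊆E e (BadAt-∈Enq i bad) e≺d⊥)
  where
  open IsSafe S

  E-below : ∀ {x y} → y ∈Enq c → D x ⊎ E x → y ≺[ c ] x → E y
  E-below {x} {y} y∈ x∈ y≺x with closed x y x∈ y≺x
  ... | inj₁ Dy = ⊥-elim (IsEnq⇒¬IsDeq (proj₂ y∈) (proj₂ (D⊆Deq y Dy)))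
  ... | inj₂ Ey = Ey

  bad∉E : ∀ i {e} → BadAt c Match d⊥ i e → ¬ E e
  bad∉E zero {e} (_ , inj₁ d⊥≺e) Ee = notAfter e (inj₂ Ee) d⊥≺e
  bad∉E zero {e} (_ , inj₂ matchersAfter) Ee with E⊆MatchD e Ee
  ... | d , Dd , de = notAfter d (inj₁ Dd) (matchersAfter d (D⊆Deq d Dd) de)
  bad∉E (suc i) {e} (_ , eᵢ , badᵢ , inj₁ eᵢ≺e) Ee =
    bad∉E i badᵢ (E-below (BadAt-∈Enq i badᵢ) (inj₂ Ee) eᵢ≺e)
  bad∉E (suc i) {e} (_ , eᵢ , badᵢ , inj₂ (d , d∈ , de , eᵢ≺d)) Ee with E⊆MatchD e Ee
  ... | d′ , Dd′ , d′e = bad∉E i badᵢ (E-below (BadAt-∈Enq i badᵢ) (inj₁ Dd) eᵢ≺d)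
    where
    Dd : D d
    Dd = subst D (sym (safe-inj d d′ e d∈ (D⊆Deq d′ Dd′) de d′e)) Dd′

module _ {c : History} (H : IsHistory c) {Match : Event → Maybe Event}
         (O : IsOrdered c Match) (d⊥ : Event) where
  open IsOrdered O
  open IsSafe isSafe

  private
    B : Event → Set
    B = Bad c Match d⊥

  Above : Event → Set
  Above x = d⊥ ≺[ c ] x ⊎ Σ Event λ e → B e × e ≺[ c ] x

  MatchedToBad : Event → Set
  MatchedToBad d = d ∈Deq c × Σ Event λ e → Match d ≡ just e × B e

  Tainted : Event → Set
  Tainted x = Above x ⊎ B x ⊎ MatchedToBad x

  -- Interval property against the reason e is bad; the alternative d ≺ e is
  -- excluded by the first ordering condition.
  matchedToBad-≺ : ∀ {d x} → MatchedToBad d → d ≺[ c ] x → Above x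
  matchedToBad-≺ (d∈ , e , de , zero , _ , inj₁ d⊥≺e) d≺x with ≺-interval {c} d⊥≺e d≺x
  ... | inj₁ d⊥≺x = inj₁ d⊥≺x
  ... | inj₂ d≺e  = ⊥-elim (ordered₁ _ e d∈ de d≺e)
  matchedToBad-≺ (d∈ , e , de , zero , _ , inj₂ matchersAfter) d≺x =
    inj₁ (≺-trans H (matchersAfter _ d∈ de) d≺x)
  matchedToBad-≺ (d∈ , e , de , suc i , _ , eᵢ , badᵢ , inj₁ eᵢ≺e) d≺x
    with ≺-interval {c} eᵢ≺e d≺x
  ... | inj₁ eᵢ≺x = inj₂ (eᵢ , (i , badᵢ) , eᵢ≺x)
  ... | inj₂ d≺e  = ⊥-elim (ordered₁ _ e d∈ de d≺e)
  matchedToBad-≺ (d∈ , e , de , suc i , _ , eᵢ , badᵢ , inj₂ (d′ , d′∈ , d′e , eᵢ≺d′)) d≺x =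
    inj₂ (eᵢ , (i , badᵢ) , ≺-trans H (subst (eᵢ ≺[ c ]_) d′≡d eᵢ≺d′) d≺x)
    where d′≡d = safe-inj _ _ e d′∈ d∈ d′e de

  tainted-≺ : ∀ {a b} → Tainted b → b ≺[ c ] a → Above a
  tainted-≺ (inj₁ (inj₁ d⊥≺b))            b≺a = inj₁ (≺-trans H d⊥≺b b≺a)
  tainted-≺ (inj₁ (inj₂ (e , bad , e≺b))) b≺a = inj₂ (e , bad , ≺-trans H e≺b b≺a)
  tainted-≺ (inj₂ (inj₁ bad))              b≺a = inj₂ (_ , bad , b≺a)
  tainted-≺ (inj₂ (inj₂ matched))          b≺a = matchedToBad-≺ matched b≺a

  tainted-enq⇒bad : ∀ {e} → e ∈Enq c → Tainted e → B e
  tainted-enq⇒bad e∈ (inj₁ (inj₁ d⊥≺e))                 = zero , e∈ , inj₁ d⊥≺e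
  tainted-enq⇒bad e∈ (inj₁ (inj₂ (eᵢ , (i , badᵢ) , eᵢ≺e))) = suc i , e∈ , eᵢ , badᵢ , inj₁ eᵢ≺e
  tainted-enq⇒bad e∈ (inj₂ (inj₁ bad))                  = bad
  tainted-enq⇒bad e∈ (inj₂ (inj₂ ((_ , isDeq) , _)))     = ⊥-elim (IsEnq⇒¬IsDeq (proj₂ e∈) isDeq)

  -- For d⊥ ≺ d this uses that d is the only dequeue matched to e.
  above-matcher⇒bad : ∀ {d e} → d ∈Deq c → Match d ≡ just e → e ∈Enq c → Above d → B e
  above-matcher⇒bad {d} {e} d∈ de e∈ (inj₁ d⊥≺d) = zero , e∈ , inj₂ matchersAfter
    where
    matchersAfter : ∀ d′ → d′ ∈Deq c → Match d′ ≡ just e → d⊥ ≺[ c ] d′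
    matchersAfter d′ d′∈ d′e = subst (d⊥ ≺[ c ]_) (safe-inj d d′ e d∈ d′∈ de d′e) d⊥≺d
  above-matcher⇒bad {d} d∈ de e∈ (inj₂ (eᵢ , (i , badᵢ) , eᵢ≺d)) =
    suc i , e∈ , eᵢ , badᵢ , inj₂ (d , d∈ , de , eᵢ≺d)

  UntaintedDeq UntaintedEnq : Event → Set
  UntaintedDeq x = x ∈Deq c × ¬ Tainted x
  UntaintedEnq x = x ∈Enq c × ¬ Tainted x

  untainted-split : ∀ {x} → x ∈Ev c → ¬ Tainted x → UntaintedDeq x ⊎ UntaintedEnq x
  untainted-split {enq _ _} x∈ clean = inj₂ ((x∈ , isEnq) , clean)
  untainted-split {deq _ _} x∈ clean = inj₁ ((x∈ , isDeq) , clean)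

  untainted : ∀ {x} → UntaintedDeq x ⊎ UntaintedEnq x → ¬ Tainted x
  untainted (inj₁ (_ , clean)) = clean
  untainted (inj₂ (_ , clean)) = clean

  untaintedEnq-matched : ∀ e → UntaintedEnq e → Σ Event λ d → UntaintedDeq d × Match d ≡ just e
  untaintedEnq-matched e (e∈ , clean)
    with search-inv (λ d → isDeq? d ×-dec (Match d ≟ just e)) c
    where _≟_ = ≡-decMaybe _≟ᴱ_
  ... | inj₂ unmatched = ⊥-elim (clean (inj₂ (inj₁ (zero , e∈ , inj₂ vacuous))))
    where
    vacuous : ∀ d → d ∈Deq c → Match d ≡ just e → d⊥ ≺[ c ] d
    vacuous d (d∈ , isDeq) de = ⊥-elim (unmatched d d∈ (isDeq , de))
  ... | inj₁ (d , d∈c , dDeq , de) = d , (d∈ , cleanD) , de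
    where
    d∈ : d ∈Deq c
    d∈ = d∈c , dDeq
    cleanD : ¬ Tainted d
    cleanD (inj₁ above) = clean (inj₂ (inj₁ (above-matcher⇒bad d∈ de e∈ above)))
    cleanD (inj₂ (inj₁ (i , bad))) = IsEnq⇒¬IsDeq (proj₂ (BadAt-∈Enq i bad)) dDeq
    cleanD (inj₂ (inj₂ (_ , e′ , de′ , bad′))) =
      clean (inj₂ (inj₁ (subst B (just-injective (trans (sym de′) de)) bad′)))

  BadBeforeEmpty⇒DESets : BadBeforeEmpty c Match d⊥ → DESets c Match d⊥
  BadBeforeEmpty⇒DESets badNotBefore =
    UntaintedDeq , UntaintedEnq , (λ _ → proj₁) , (λ _ → proj₁) ,
    (λ x x∈ d⊥≺x → untainted x∈ (inj₁ (inj₁ d⊥≺x))) ,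
    (λ a b a∈ b≺a → untainted-split (≺-∈Ev H b≺a)
                      (λ taintedB → untainted a∈ (inj₁ (tainted-≺ taintedB b≺a)))) ,
    (λ e e∈ e≺d⊥ → e∈ , λ tainted → badNotBefore e (tainted-enq⇒bad e∈ tainted) e≺d⊥) ,
    untaintedEnq-matched

lemma4p4 : (c : History) → IsCompleteHistory c →
    (Match : Event → Maybe Event) → IsOrdered c Match →
    (d⊥ : Event) → d⊥ ∈Deq c → Match d⊥ ≡ nothing →
    (BadBeforeEmpty c Match d⊥ → DESets c Match d⊥) ×
    (DESets c Match d⊥ → BadBeforeEmpty c Match d⊥)
lemma4p4 c complete Match ordered d⊥ _ _ =
  BadBeforeEmpty⇒DESets (IsCompleteHistory.isHistory complete) ordered d⊥ ,
  DESets⇒BadBeforeEmpty (IsOrdered.isSafe ordered)
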